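{- Let $\mathcal{D}$ be the Hopf algebra of digraphs over $\mathbb{Q}$ and let $\zeta:\mathcal{D}\to\mathbb{Q}$ be the linear functional defined on isomorphism classes of digraphs $X=(V,E)$ by \[\zeta([X])=\#\{\sigma\in\Sigma_V \mid X\mathrm{Des}(\sigma)=\emptyset\},\] i.e. the number of Hamiltonian paths of the complementary digraph $\overline{X}$. Then $\zeta$ is multiplicative: $\zeta([X\cdot Y])=\zeta([X])\,\zeta([Y])$ for all digraphs $X,Y$ (and $\zeta([\emptyset])=1$).
   Context: A digraph is a pair $X=(V,E)$ with $V$ a finite set and $E\subset\{(u,v)\in V\times V\mid u\neq v\}$. Isomorphism of digraphs is a bijection of vertex sets preserving and reflecting directed edges. A $V$-listing is a bijection $\sigma:[n]\to V$, $n=|V|$, written $(\sigma_1,\dots,\sigma_n)$; $\Sigma_V$ is the set of $V$-listings. The $X$-descent set is $X\mathrm{Des}(\sigma)=\{1\le i\le n-1\mid (\sigma_i,\sigma_{i+1})\in E\}$. A Hamiltonian path of $X$ is a $\sigma$ with $X\mathrm{Des}(\sigma)=[n-1]$. The complementary digraph is $\overline{X}=(V,E^c)$ where $(u,v)\in E^c$ iff $u\ne v$ and $(u,v)\notin E$. For $S\subset V$, the restriction $X|_S=(S,\{(u,v)\in E\mid u,v\in S\})$. The product $X\cdot Y$ of $X=(V,E)$ and $Y=(V',E')$ is the digraph on $V\sqcup V'$ with edge set $E\cup E'\cup\{(u,v)\mid u\in V, v\in V'\}$. $\mathcal{D}=\bigoplus_{n\ge0}\mathcal{D}_n$ is the $\mathbb{Q}$-vector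 space with basis the isomorphism classes $[X]$ of digraphs, graded by number of vertices, with multiplication $[X]\cdot[Y]=[X\cdot Y]$, unit $[\emptyset]$, comultiplication $\Delta([X])=\sum_{S\subset V}[X|_S]\otimes[X|_{V\setminus S}]$, and counit $\epsilon([\emptyset])=1$, $\epsilon([X])=0$ otherwise. -}

module Defs where

open import Data.Nat using (ℕ; zero; suc; _+_)
open import Data.Bool using (Bool; true; false; _∧_; not)
open import Data.Fin using (Fin; _≟_; splitAt)
open import Data.Fin.Base using ()
open import Data.Sum using (_⊎_; inj₁; inj₂)
open import Data.List using (List; []; _∷_; map; concatMap; length; filterᵇ)
open import Data.List using () renaming (allFin to allFinL)
open import Data.Vec using (Vec; []; _∷_)
open import Relation.Nullary.Decidable using (⌊_⌋)
open import Relation.Binary.PropositionalEquality using (_≡_; refl)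

record Digraph (n : ℕ) : Set where
  field
    edge   : Fin n → Fin n → Bool
    irrefl : ∀ v → edge v v ≡ false
open Digraph public

emptyDigraph : Digraph 0
emptyDigraph = record { edge = λ () ; irrefl = λ () }

prodEdge : ∀ {m n} → Digraph m → Digraph n → Fin m ⊎ Fin n → Fin m ⊎ Fin n → Bool
prodEdge X Y (inj₁ u) (inj₁ v) = edge X u v
prodEdge X Y (inj₁ u) (inj₂ v) = true
prodEdge X Y (inj₂ u) (inj₁ v) = false
prodEdge X Y (inj₂ u) (inj₂ v) = edge Y u v

prodIrrefl : ∀ {m n} (X : Digraph m) (Y : Digraph n) (w : Fin m ⊎ Fin n) → prodEdge X Y w w ≡ false
prodIrrefl X Y (inj₁ u) = irrefl X u
prodIrrefl X Y (inj₂ v) = irrefl Y v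

_·_ : ∀ {m n} → Digraph m → Digraph n → Digraph (m + n)
_·_ {m} X Y = record
  { edge   = λ u v → prodEdge X Y (splitAt m u) (splitAt m v)
  ; irrefl = λ w → prodIrrefl X Y (splitAt m w) }

allVecs : (n k : ℕ) → List (Vec (Fin n) k)
allVecs n zero    = [] ∷ []
allVecs n (suc k) = concatMap (λ i → map (i ∷_) (allVecs n k)) (allFinL n)

notIn : ∀ {n k} → Fin n → Vec (Fin n) k → Bool
notIn v []       = true
notIn v (w ∷ ws) = not ⌊ v ≟ w ⌋ ∧ notIn v ws

distinct : ∀ {n k} → Vec (Fin n) k → Bool
distinct []       = true
distinct (v ∷ vs) = notIn v vs ∧ distinct vs

-- A V-listing (V = Fin n) is a bijection [n] → V, i.e. a length-n sequence of
-- pairwise distinct vertices.  The listings of Fin n are enumerated (each once) by: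
listings : (n : ℕ) → List (Vec (Fin n) n)
listings n = filterᵇ distinct (allVecs n n)

noDescent : ∀ {n k} → Digraph n → Vec (Fin n) k → Bool
noDescent X []           = true
noDescent X (u ∷ [])     = true
noDescent X (u ∷ v ∷ vs) = not (edge X u v) ∧ noDescent X (v ∷ vs)

ζ : ∀ {n} → Digraph n → ℕ
ζ {n} X = length (filterᵇ (noDescent X) (listings n))

{-# OPTIONS --safe #-}
-- Every pair (x , y) with x a vertex of X and y a vertex of Y is an edge of X · Y, so in a
-- listing of X · Y with empty descent set no vertex of X is immediately followed by one of Y.
-- Such a listing is therefore a listing of Y followed by a listing of X, and its descent set is
-- empty iff both parts have empty descent set.  This bijection between the descent-free listings
-- of X · Y and pairs of descent-free listings of Y and X gives ζ (X · Y) = ζ Y ζ X; it is counted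
-- by showing that both families form duplicate-free lists with the same members.
module Submission where

open import Defs
open import Data.Nat using (ℕ; _*_)
open import Data.Product using (_×_)
open import Relation.Binary.PropositionalEquality using (_≡_)

open import Level using (Level)
open import Data.Bool using (T; not; false)
open import Data.Bool.Properties using (T-∧)
open import Data.Empty using (⊥-elim)
open import Data.Fin as Fin using (Fin; _↑ˡ_; _↑ʳ_; splitAt)
open import Data.Fin.Properties using (splitAt-↑ˡ; splitAt-↑ʳ; splitAt⁻¹-↑ˡ; splitAt⁻¹-↑ʳ; ↑ˡ-injective; ↑ʳ-injective)
open import Data.List using (List; []; _∷_; _++_; map; concatMap; length; filter; filterᵇ; allFin; cartesianProductWith)
open import Data.List.Membership.Propositional using (_∈_)
open import Data.List.Membership.Propositional.Properties using (∈-map⁺; ∈-map⁻; ∈-filter⁺; ∈-filter⁻; ∈-allFin; ∈-cartesianProductWith⁺; ∈-cartesianProductWith⁻)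
open import Data.List.Membership.Propositional.Properties.WithK using (unique∧set⇒bag)
import Data.List.Membership.DecPropositional as DecMembership
open import Data.List.Properties using (length-map; length-++; length-filter; length-tabulate; map-injective; ∷-injectiveˡ; ∷-injectiveʳ)
open import Data.List.Relation.Binary.BagAndSetEquality using (∼bag⇒↭)
open import Data.List.Relation.Binary.Disjoint.Propositional using (Disjoint)
open import Data.List.Relation.Binary.Permutation.Propositional.Properties using (↭-length)
open import Data.List.Relation.Unary.All as All using (All; []; _∷_)
open import Data.List.Relation.Unary.All.Properties using () renaming (++⁻ˡ to All-++⁻ˡ)
open import Data.List.Relation.Unary.AllPairs as AllPairs using (AllPairs; []; _∷_)
open import Data.List.Relation.Unary.Any using (here)
open import Data.List.Relation.Unary.Linked as Linked using (Linked; []; [-]; _∷_)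
import Data.List.Relation.Unary.Linked.Properties as Linkedₚ
open import Data.List.Relation.Unary.Unique.Propositional using (Unique)
import Data.List.Relation.Unary.Unique.Propositional.Properties as Uniqueₚ
open import Data.Nat using (_+_; _≤_; suc; zero)
open import Data.Nat.Properties using (≤-antisym; +-monoˡ-≤; +-monoʳ-≤; +-cancelˡ-≤; +-cancelʳ-≤; +-comm; *-comm; module ≤-Reasoning)
open import Data.Product using (_,_; proj₂; ∃; ∃₂)
open import Data.Sum using (inj₁; inj₂)
open import Data.Unit using (tt)
open import Data.Vec using (Vec; []; _∷_; toList; fromList; cast)
import Data.Vec.Properties as Vecₚ
open import Data.Vec.Relation.Binary.Equality.Cast using (cast-is-id)
open import Function using (_∘_; _on_; id; const; Injective)
open import Function.Bundles using (_⇔_; mk⇔; Equivalence)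
open import Relation.Binary.PropositionalEquality using (refl; sym; trans; cong; cong₂; subst; _≢_; module ≡-Reasoning)
open import Relation.Nullary.Decidable using (T?; yes; no)

open Equivalence using (to; from)

private
  variable
    a b c ℓ : Level
    A : Set a
    B : Set b
    C : Set c
    k n : ℕ

unique∧set⇒length≡ : {xs ys : List A} → Unique xs → Unique ys →
                     (∀ {x} → x ∈ xs ⇔ x ∈ ys) → length xs ≡ length ys
unique∧set⇒length≡ xs! ys! xs≈ys = ↭-length (∼bag⇒↭ (unique∧set⇒bag xs! ys! xs≈ys))

Unique⇒length≤ : {xs : List (Fin n)} → Unique xs → length xs ≤ n
Unique⇒length≤ {n} {xs} xs! = begin
  length xs                           ≡⟨ unique∧set⇒length≡ xs! (Uniqueₚ.filter⁺ (_∈? xs) (Uniqueₚ.allFin⁺ n)) members ⟩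
  length (filter (_∈? xs) (allFin n)) ≤⟨ length-filter (_∈? xs) (allFin n) ⟩
  length (allFin n)                   ≡⟨ length-tabulate id ⟩
  n                                   ∎
  where
  open DecMembership (Fin._≟_ {n}) using (_∈?_)
  open ≤-Reasoning
  members : ∀ {x} → x ∈ xs ⇔ x ∈ filter (_∈? xs) (allFin n)
  members {x} = mk⇔ (∈-filter⁺ (_∈? xs) (∈-allFin x)) (proj₂ ∘ ∈-filter⁻ (_∈? xs) {xs = allFin n})

m≤o∧n≤p∧m+n≡o+p⇒≡ : ∀ {m n o p} → m ≤ o → n ≤ p → m + n ≡ o + p → m ≡ o × n ≡ p
m≤o∧n≤p∧m+n≡o+p⇒≡ {m} {n} {o} {p} m≤o n≤p eq =
  ≤-antisym m≤o (+-cancelʳ-≤ p o m (begin o + p ≡⟨ sym eq ⟩ m + n ≤⟨ +-monoʳ-≤ m n≤p ⟩ m + p ∎)) ,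
  ≤-antisym n≤p (+-cancelˡ-≤ o p n (begin o + p ≡⟨ sym eq ⟩ m + n ≤⟨ +-monoˡ-≤ n m≤o ⟩ o + n ∎))
  where open ≤-Reasoning

length-cartesianProductWith : (f : A → B → C) (xs : List A) (ys : List B) →
                              length (cartesianProductWith f xs ys) ≡ length xs * length ys
length-cartesianProductWith f []       ys = refl
length-cartesianProductWith f (x ∷ xs) ys = begin
  length (map (f x) ys ++ cartesianProductWith f xs ys)         ≡⟨ length-++ (map (f x) ys) ⟩
  length (map (f x) ys) + length (cartesianProductWith f xs ys) ≡⟨ cong₂ _+_ (length-map (f x) ys)
                                                                           (length-cartesianProductWith f xs ys) ⟩
  length ys + length xs * length ys                             ∎
  where open ≡-Reasoning

cartesianProductWith≡concatMap : (f : A → B → C) (xs : List A) (ys : List B) →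
                                 cartesianProductWith f xs ys ≡ concatMap (λ x → map (f x) ys) xs
cartesianProductWith≡concatMap f []       ys = refl
cartesianProductWith≡concatMap f (x ∷ xs) ys = cong (map (f x) ys ++_) (cartesianProductWith≡concatMap f xs ys)

AllPairs-++⁻ : {R : A → A → Set ℓ} (xs : List A) {ys : List A} →
               AllPairs R (xs ++ ys) → AllPairs R xs × AllPairs R ys
AllPairs-++⁻ []       Rys           = [] , Rys
AllPairs-++⁻ (x ∷ xs) (Rx ∷ Rxs++ys) =
  let Rxs , Rys = AllPairs-++⁻ xs Rxs++ys in All-++⁻ˡ xs Rx ∷ Rxs , Rys

Linked-++⁻ : {R : A → A → Set ℓ} (xs : List A) {ys : List A} →
             Linked R (xs ++ ys) → Linked R xs × Linked R ys
Linked-++⁻ []            Rys             = [] , Rys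
Linked-++⁻ (x ∷ [])      Rx∷ys           = [-] , Linked.tail Rx∷ys
Linked-++⁻ (x ∷ x′ ∷ xs) (Rxx′ ∷ Rx′∷xs++ys) =
  let Rx′∷xs , Rys = Linked-++⁻ (x′ ∷ xs) Rx′∷xs++ys in Rxx′ ∷ Rx′∷xs , Rys

Linked-map-++-map⁺ : {R : B → B → Set ℓ} {f : A → B} {g : C → B} {xs : List A} {ys : List C} →
                     (∀ x y → R (f x) (g y)) → Linked (R on f) xs → Linked (R on g) ys →
                     Linked R (map f xs ++ map g ys)
Linked-map-++-map⁺                       Rfg []            Rys = Linkedₚ.map⁺ Rys
Linked-map-++-map⁺ {xs = x ∷ []} {[]}     Rfg [-]           Rys = [-]
Linked-map-++-map⁺ {xs = x ∷ []} {y ∷ ys} Rfg [-]           Rys = Rfg x y ∷ Linkedₚ.map⁺ Rys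
Linked-map-++-map⁺                       Rfg (Rxx′ ∷ Rxs) Rys = Rxx′ ∷ Linked-map-++-map⁺ Rfg Rxs Rys

module _ {f : A → B} {g : C → B} (f-inj : Injective _≡_ _≡_ f) (g-inj : Injective _≡_ _≡_ g)
         (f≢g : ∀ x y → f x ≢ g y) where

  map-++-map-injective : ∀ {xs xs′ ys ys′} → map f xs ++ map g ys ≡ map f xs′ ++ map g ys′ →
                         xs ≡ xs′ × ys ≡ ys′
  map-++-map-injective {[]}     {[]}                  eq = refl , map-injective g-inj eq
  map-++-map-injective {[]}     {x′ ∷ _} {y ∷ _}       eq = ⊥-elim (f≢g x′ y (sym (∷-injectiveˡ eq)))
  map-++-map-injective {x ∷ _}  {[]}     {_} {y′ ∷ _}  eq = ⊥-elim (f≢g x y′ (∷-injectiveˡ eq))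
  map-++-map-injective {x ∷ xs} {x′ ∷ xs′}             eq =
    let xs≡xs′ , ys≡ys′ = map-++-map-injective (∷-injectiveʳ eq)
    in cong₂ _∷_ (f-inj (∷-injectiveˡ eq)) xs≡xs′ , ys≡ys′

  Unique-map-++-map⇔ : ∀ {xs ys} → Unique (map f xs ++ map g ys) ⇔ (Unique xs × Unique ys)
  Unique-map-++-map⇔ {xs} {ys} = mk⇔
    (λ fxs++gys! → let fxs! , gys! = AllPairs-++⁻ (map f xs) fxs++gys! in Uniqueₚ.map⁻ fxs! , Uniqueₚ.map⁻ gys!)
    (λ (xs! , ys!) → Uniqueₚ.++⁺ (Uniqueₚ.map⁺ f-inj xs!) (Uniqueₚ.map⁺ g-inj ys!) disjoint)
    where
    disjoint : Disjoint (map f xs) (map g ys)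
    disjoint (v∈fxs , v∈gys) with ∈-map⁻ f v∈fxs | ∈-map⁻ g v∈gys
    ... | x , _ , refl | y , _ , fx≡gy = f≢g x y fx≡gy

toList-injective : {σ τ : Vec A k} → toList σ ≡ toList τ → σ ≡ τ
toList-injective {σ = σ} {τ} eq = trans (sym (cast-is-id refl σ)) (Vecₚ.toList-injective refl σ τ eq)

toList-surjective : (xs : List A) → length xs ≡ k → ∃ λ (σ : Vec A k) → toList σ ≡ xs
toList-surjective xs eq = cast eq (fromList xs) , trans (Vecₚ.toList-cast eq (fromList xs)) (Vecₚ.toList∘fromList xs)

allVecs-unique : ∀ n k → Unique (allVecs n k)
allVecs-unique n zero    = [] ∷ []
allVecs-unique n (suc k) = subst Unique (cartesianProductWith≡concatMap _∷_ (allFin n) (allVecs n k))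
  (Uniqueₚ.cartesianProductWith⁺ _∷_ Vecₚ.∷-injective (Uniqueₚ.allFin⁺ n) (allVecs-unique n k))

∈-allVecs : (σ : Vec (Fin n) k) → σ ∈ allVecs n k
∈-allVecs             []      = here refl
∈-allVecs {n} {suc k} (v ∷ σ) = subst (v ∷ σ ∈_) (cartesianProductWith≡concatMap _∷_ (allFin n) (allVecs n k))
  (∈-cartesianProductWith⁺ _∷_ (∈-allFin v) (∈-allVecs σ))

NonEdge : Digraph n → Fin n → Fin n → Set
NonEdge X u v = T (not (edge X u v))

DescentFreeListing : Digraph n → List (Fin n) → Set
DescentFreeListing {n} X σ = length σ ≡ n × Unique σ × Linked (NonEdge X) σ

T-notIn : (v : Fin n) (σ : Vec (Fin n) k) → T (notIn v σ) ⇔ All (v ≢_) (toList σ)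
T-notIn v []      = mk⇔ (const []) (const tt)
T-notIn v (w ∷ σ) with v Fin.≟ w
... | yes v≡w = mk⇔ (λ ()) (λ v∉w∷σ → All.head v∉w∷σ v≡w)
... | no  v≢w = mk⇔ ((v≢w ∷_) ∘ to (T-notIn v σ)) (from (T-notIn v σ) ∘ All.tail)

T-distinct : (σ : Vec (Fin n) k) → T (distinct σ) ⇔ Unique (toList σ)
T-distinct []      = mk⇔ (const []) (const tt)
T-distinct (v ∷ σ) = mk⇔
  (λ t → let v∉σ , σ! = to T-∧ t in to (T-notIn v σ) v∉σ ∷ to (T-distinct σ) σ!)
  (λ v∷σ! → from T-∧ (from (T-notIn v σ) (AllPairs.head v∷σ!) , from (T-distinct σ) (AllPairs.tail v∷σ!)))

T-noDescent : (X : Digraph n) (σ : Vec (Fin n) k) → T (noDescent X σ) ⇔ Linked (NonEdge X) (toList σ)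
T-noDescent X []          = mk⇔ (const []) (const tt)
T-noDescent X (u ∷ [])    = mk⇔ (const [-]) (const tt)
T-noDescent X (u ∷ v ∷ σ) = mk⇔
  (λ t → let uv , v∷σ-linked = to T-∧ t in uv ∷ to (T-noDescent X (v ∷ σ)) v∷σ-linked)
  (λ u∷v∷σ-linked → from T-∧ (Linked.head u∷v∷σ-linked , from (T-noDescent X (v ∷ σ)) (Linked.tail u∷v∷σ-linked)))

descentFreeListings : Digraph n → List (List (Fin n))
descentFreeListings {n} X = map toList (filterᵇ (noDescent X) (listings n))

ζ≡length-descentFreeListings : (X : Digraph n) → ζ X ≡ length (descentFreeListings X)
ζ≡length-descentFreeListings {n} X = sym (length-map toList (filterᵇ (noDescent X) (listings n)))

descentFreeListings-unique : (X : Digraph n) → Unique (descentFreeListings X)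
descentFreeListings-unique {n} X = Uniqueₚ.map⁺ toList-injective
  (Uniqueₚ.filter⁺ (T? ∘ noDescent X) (Uniqueₚ.filter⁺ (T? ∘ distinct) (allVecs-unique n n)))

∈-descentFreeListings⁻ : {X : Digraph n} {σ : List (Fin n)} →
                         σ ∈ descentFreeListings X → DescentFreeListing X σ
∈-descentFreeListings⁻ {X = X} σ∈ with ∈-map⁻ toList σ∈
... | τ , τ∈ , refl with ∈-filter⁻ (T? ∘ noDescent X) {xs = listings _} τ∈
... | τ∈listings , τ-noDescent =
  Vecₚ.length-toList τ ,
  to (T-distinct τ) (proj₂ (∈-filter⁻ (T? ∘ distinct) {xs = allVecs _ _} τ∈listings)) ,
  to (T-noDescent X τ) τ-noDescent

∈-descentFreeListings⁺ : {X : Digraph n} {σ : List (Fin n)} →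
                         DescentFreeListing X σ → σ ∈ descentFreeListings X
∈-descentFreeListings⁺ {X = X} {σ} (σ-length , σ! , σ-linked) with toList-surjective σ σ-length
... | τ , refl = ∈-map⁺ toList (∈-filter⁺ (T? ∘ noDescent X)
  (∈-filter⁺ (T? ∘ distinct) (∈-allVecs τ) (from (T-distinct τ) σ!)) (from (T-noDescent X τ) σ-linked))

↑ʳ≢↑ˡ : ∀ m {n} (j : Fin n) (i : Fin m) → m ↑ʳ j ≢ i ↑ˡ n
↑ʳ≢↑ˡ m {n} j i eq with trans (sym (splitAt-↑ʳ m n j)) (trans (cong (splitAt m) eq) (splitAt-↑ˡ m i n))
... | ()

module _ {m n} (X : Digraph m) (Y : Digraph n) where

  joinListings : List (Fin n) → List (Fin m) → List (Fin (m + n))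
  joinListings σʸ σˣ = map (m ↑ʳ_) σʸ ++ map (_↑ˡ n) σˣ

  edge-·-↑ʳ : ∀ j j′ → edge (X · Y) (m ↑ʳ j) (m ↑ʳ j′) ≡ edge Y j j′
  edge-·-↑ʳ j j′ = cong₂ (prodEdge X Y) (splitAt-↑ʳ m n j) (splitAt-↑ʳ m n j′)

  edge-·-↑ˡ : ∀ i i′ → edge (X · Y) (i ↑ˡ n) (i′ ↑ˡ n) ≡ edge X i i′
  edge-·-↑ˡ i i′ = cong₂ (prodEdge X Y) (splitAt-↑ˡ m i n) (splitAt-↑ˡ m i′ n)

  edge-·-↑ʳ-↑ˡ : ∀ j i → edge (X · Y) (m ↑ʳ j) (i ↑ˡ n) ≡ false
  edge-·-↑ʳ-↑ˡ j i = cong₂ (prodEdge X Y) (splitAt-↑ʳ m n j) (splitAt-↑ˡ m i n)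

  length-joinListings : ∀ σʸ σˣ → length (joinListings σʸ σˣ) ≡ length σʸ + length σˣ
  length-joinListings σʸ σˣ =
    trans (length-++ (map (m ↑ʳ_) σʸ)) (cong₂ _+_ (length-map (m ↑ʳ_) σʸ) (length-map (_↑ˡ n) σˣ))

  joinListings-injective : ∀ {σʸ τʸ σˣ τˣ} → joinListings σʸ σˣ ≡ joinListings τʸ τˣ → σʸ ≡ τʸ × σˣ ≡ τˣ
  joinListings-injective = map-++-map-injective (↑ʳ-injective m _ _) (↑ˡ-injective n _ _) (↑ʳ≢↑ˡ m)

  Unique-joinListings⇔ : ∀ {σʸ σˣ} → Unique (joinListings σʸ σˣ) ⇔ (Unique σʸ × Unique σˣ)
  Unique-joinListings⇔ = Unique-map-++-map⇔ (↑ʳ-injective m _ _) (↑ˡ-injective n _ _) (↑ʳ≢↑ˡ m)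

  Linked-joinListings⁻ : ∀ {σʸ σˣ} → Linked (NonEdge (X · Y)) (joinListings σʸ σˣ) →
                         Linked (NonEdge Y) σʸ × Linked (NonEdge X) σˣ
  Linked-joinListings⁻ {σʸ} linked =
    let σʸ-linked , σˣ-linked = Linked-++⁻ (map (m ↑ʳ_) σʸ) linked
    in Linked.map (λ {j} {j′} → subst (T ∘ not) (edge-·-↑ʳ j j′)) (Linkedₚ.map⁻ σʸ-linked) ,
       Linked.map (λ {i} {i′} → subst (T ∘ not) (edge-·-↑ˡ i i′)) (Linkedₚ.map⁻ σˣ-linked)

  Linked-joinListings⁺ : ∀ {σʸ σˣ} → Linked (NonEdge Y) σʸ → Linked (NonEdge X) σˣ →
                         Linked (NonEdge (X · Y)) (joinListings σʸ σˣ)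
  Linked-joinListings⁺ σʸ-linked σˣ-linked = Linked-map-++-map⁺
    (λ j i → subst (T ∘ not) (sym (edge-·-↑ʳ-↑ˡ j i)) tt)
    (Linked.map (λ {j} {j′} → subst (T ∘ not) (sym (edge-·-↑ʳ j j′))) σʸ-linked)
    (Linked.map (λ {i} {i′} → subst (T ∘ not) (sym (edge-·-↑ˡ i i′))) σˣ-linked)

  -- An X-vertex followed by a Y-vertex is an edge of X · Y, so after the first X-vertex no Y-vertex can occur.
  Linked⇒joinListings : ∀ {σ} → Linked (NonEdge (X · Y)) σ → ∃₂ λ σʸ σˣ → σ ≡ joinListings σʸ σˣ
  Linked⇒joinListings {[]}    []     = [] , [] , refl
  Linked⇒joinListings {u ∷ σ} linked with Linked⇒joinListings (Linked.tail linked) | splitAt m u in u≡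
  ... | σʸ , σˣ , refl | inj₂ j = j ∷ σʸ , σˣ , cong (_∷ _) (sym (splitAt⁻¹-↑ʳ u≡))
  ... | [] , σˣ , refl | inj₁ i = [] , i ∷ σˣ , cong (_∷ _) (sym (splitAt⁻¹-↑ˡ u≡))
  ... | j ∷ _ , _ , refl | inj₁ i =
    ⊥-elim (subst (T ∘ not) (cong₂ (prodEdge X Y) u≡ (splitAt-↑ʳ m n j)) (Linked.head linked))

  DescentFreeListing-joinListings⇔ : ∀ {σʸ σˣ} → DescentFreeListing (X · Y) (joinListings σʸ σˣ) ⇔
                                     (DescentFreeListing Y σʸ × DescentFreeListing X σˣ)
  DescentFreeListing-joinListings⇔ {σʸ} {σˣ} = mk⇔ split assemble
    where
    split : DescentFreeListing (X · Y) (joinListings σʸ σˣ) →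
            DescentFreeListing Y σʸ × DescentFreeListing X σˣ
    split (σ-length , σ! , σ-linked) =
      let σʸ! , σˣ! = to Unique-joinListings⇔ σ!
          σʸ-linked , σˣ-linked = Linked-joinListings⁻ σ-linked
          σʸ-length , σˣ-length = m≤o∧n≤p∧m+n≡o+p⇒≡ (Unique⇒length≤ σʸ!) (Unique⇒length≤ σˣ!)
            (trans (sym (length-joinListings σʸ σˣ)) (trans σ-length (+-comm m n)))
      in (σʸ-length , σʸ! , σʸ-linked) , (σˣ-length , σˣ! , σˣ-linked)
    assemble : DescentFreeListing Y σʸ × DescentFreeListing X σˣ →
               DescentFreeListing (X · Y) (joinListings σʸ σˣ)
    assemble ((σʸ-length , σʸ! , σʸ-linked) , (σˣ-length , σˣ! , σˣ-linked)) =
      trans (length-joinListings σʸ σˣ) (trans (cong₂ _+_ σʸ-length σˣ-length) (+-comm n m)) ,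
      from Unique-joinListings⇔ (σʸ! , σˣ!) ,
      Linked-joinListings⁺ σʸ-linked σˣ-linked

  joinedListings : List (List (Fin (m + n)))
  joinedListings = cartesianProductWith joinListings (descentFreeListings Y) (descentFreeListings X)

  joinedListings-unique : Unique joinedListings
  joinedListings-unique = Uniqueₚ.cartesianProductWith⁺ joinListings joinListings-injective
    (descentFreeListings-unique Y) (descentFreeListings-unique X)

  descentFreeListings-·⇔ : ∀ {σ} → σ ∈ descentFreeListings (X · Y) ⇔ σ ∈ joinedListings
  descentFreeListings-·⇔ = mk⇔ split assemble
    where
    split : ∀ {σ} → σ ∈ descentFreeListings (X · Y) → σ ∈ joinedListings
    split σ∈ with ∈-descentFreeListings⁻ σ∈
    ... | σ-descentFree@(_ , _ , σ-linked) with Linked⇒joinListings σ-linked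
    ...   | σʸ , σˣ , refl =
      let σʸ-descentFree , σˣ-descentFree = to (DescentFreeListing-joinListings⇔ {σʸ} {σˣ}) σ-descentFree
      in ∈-cartesianProductWith⁺ joinListings
           (∈-descentFreeListings⁺ σʸ-descentFree) (∈-descentFreeListings⁺ σˣ-descentFree)
    assemble : ∀ {σ} → σ ∈ joinedListings → σ ∈ descentFreeListings (X · Y)
    assemble σ∈ with ∈-cartesianProductWith⁻ joinListings (descentFreeListings Y) (descentFreeListings X) σ∈
    ... | _ , _ , σʸ∈ , σˣ∈ , refl = ∈-descentFreeListings⁺
      (from DescentFreeListing-joinListings⇔ (∈-descentFreeListings⁻ σʸ∈ , ∈-descentFreeListings⁻ σˣ∈))

  ζ-· : ζ (X · Y) ≡ ζ X * ζ Y
  ζ-· = begin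
    ζ (X · Y)                            ≡⟨ ζ≡length-descentFreeListings (X · Y) ⟩
    length (descentFreeListings (X · Y)) ≡⟨ unique∧set⇒length≡ (descentFreeListings-unique (X · Y))
                                              joinedListings-unique descentFreeListings-·⇔ ⟩
    length joinedListings                ≡⟨ length-cartesianProductWith joinListings (descentFreeListings Y) _ ⟩
    length (descentFreeListings Y) * length (descentFreeListings X)
                                         ≡⟨ cong₂ _*_ (ζ≡length-descentFreeListings Y)
                                                      (ζ≡length-descentFreeListings X) ⟨
    ζ Y * ζ X                            ≡⟨ *-comm (ζ Y) (ζ X) ⟩
    ζ X * ζ Y                            ∎
    where open ≡-Reasoning

mainTheorem1 : (ζ emptyDigraph ≡ 1)
    × (∀ {m n} (X : Digraph m) (Y : Digraph n) → ζ (X · Y) ≡ ζ X * ζ Y)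
mainTheorem1 = refl , ζ-·
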